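{- For every graph $H$, $$\mathrm{tw}(H) \leq \max\{\Delta(H),\ |V(H)| - \alpha(H) - 1\}.$$
   Context: $\Delta(H)$ is the maximum degree of $H$ and $\alpha(H)$ is the size of a largest independent set of $H$. A tree decomposition of $H$ is a pair $(T,(B_x)_{x\in V(T)})$ with $T$ a tree and $B_x\subseteq V(H)$, such that for each vertex $v$ the nodes $x$ with $v\in B_x$ induce a non-empty connected subtree of $T$, and each edge of $H$ has both ends in some bag; its width is $\max_x|B_x|-1$, and $\mathrm{tw}(H)$ is the minimum width of a tree decomposition of $H$. -}

module Defs where

open import Data.Nat using (ℕ; zero; suc; _+_; _∸_; _≤_; _⊔_)
open import Data.Fin using (Fin)
open import Data.Bool using (Bool; true; false; T)
open import Data.Vec using (Vec; []; _∷_; lookup; tabulate; countᵇ; foldr; map; _++_)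
open import Data.List using (List; []; _∷_; length)
import Data.List
import Data.Bool
import Data.Nat
open import Data.List.Relation.Unary.All using (All)
open import Data.List.Relation.Unary.Unique.Propositional using (Unique)
open import Data.Product using (Σ; _×_; ∃; ∃-syntax; _,_)
open import Relation.Binary.PropositionalEquality using (_≡_; _≢_)
open import Relation.Nullary using (¬_)

record Graph (n : ℕ) : Set where
  field
    adj   : Fin n → Fin n → Bool
    sym   : ∀ u v → adj u v ≡ adj v u
    irrefl : ∀ v → adj v v ≡ false
open Graph public

Adj : ∀ {n} → Graph n → Fin n → Fin n → Set
Adj G u v = T (adj G u v)

degree : ∀ {n} → Graph n → Fin n → ℕ
degree {n} G v = countᵇ (adj G v) (tabulate {n = n} (λ u → u))

maxDegree : ∀ {n} → Graph n → ℕ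
maxDegree {n} G = foldr (λ _ → ℕ) _⊔_ 0 (tabulate {n = n} (degree G))

Subset : ℕ → Set
Subset n = Vec Bool n

_∈ₛ_ : ∀ {n} → Fin n → Subset n → Set
v ∈ₛ S = T (lookup S v)

size : ∀ {n} → Subset n → ℕ
size S = countᵇ (λ b → b) S

allSubsets : (n : ℕ) → List (Subset n)
allSubsets zero = [] ∷ []
allSubsets (suc n) =
  Data.List.map (true ∷_) (allSubsets n) Data.List.++ Data.List.map (false ∷_) (allSubsets n)

independentᵇ : ∀ {n} → Graph n → Subset n → Bool
independentᵇ {n} G S =
  foldr (λ _ → Bool) Data.Bool._∧_ true
    (tabulate {n = n} (λ u →
      foldr (λ _ → Bool) Data.Bool._∧_ true
        (tabulate {n = n} (λ v →
          Data.Bool.not (lookup S u Data.Bool.∧ lookup S v Data.Bool.∧ adj G u v)))))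

independenceNumber : ∀ {n} → Graph n → ℕ
independenceNumber {n} G =
  Data.List.foldr _⊔_ 0
    (Data.List.map (λ S → Data.Bool.if independentᵇ G S then size S else 0) (allSubsets n))

-- a walk from x to y, as a list of vertices  x = v₀, v₁, …, vₖ = y
-- with consecutive vertices adjacent
data Walk {m : ℕ} (G : Graph m) : Fin m → Fin m → List (Fin m) → Set where
  here : ∀ x → Walk G x x (x ∷ [])
  step : ∀ {x y z vs} → Adj G x y → Walk G y z vs → Walk G x z (x ∷ vs)

Connected : ∀ {m} → Graph m → Set
Connected {m} G = ∀ (x y : Fin m) → ∃[ vs ] Walk G x y vs

-- a cycle: vertices v₀ … vₖ (k ≥ 2, pairwise distinct) forming a path,
-- with vₖ adjacent to v₀
HasCycle : ∀ {m} → Graph m → Set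
HasCycle {m} G =
  ∃[ x ] ∃[ y ] ∃[ vs ] (Walk G x y vs × Unique vs × 3 ≤ length vs × Adj G y x)

IsTree : ∀ {m} → Graph m → Set
IsTree {m} G = (1 ≤ m) × Connected G × ¬ HasCycle G

record TreeDecomposition {n : ℕ} (H : Graph n) : Set where
  field
    m      : ℕ
    tree   : Graph m
    isTree : IsTree tree
    bag    : Fin m → Subset n
    nonempty : ∀ (v : Fin n) → ∃[ x ] (v ∈ₛ bag x)
    connected : ∀ (v : Fin n) (x y : Fin m) → v ∈ₛ bag x → v ∈ₛ bag y →
                ∃[ vs ] (Walk tree x y vs × All (λ z → v ∈ₛ bag z) vs)
    edges : ∀ (u v : Fin n) → Adj H u v → ∃[ x ] (u ∈ₛ bag x × v ∈ₛ bag x)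
open TreeDecomposition public

width : ∀ {n} {H : Graph n} → TreeDecomposition H → ℕ
width D = foldr (λ _ → ℕ) _⊔_ 0 (tabulate {n = m D} (λ x → size (bag D x))) ∸ 1

-- tw(H) ≤ k  iff some tree decomposition has width ≤ k
-- (tw is the minimum width, so this is the literal unfolding of "tw(H) ≤ k")
TwAtMost : ∀ {n} → Graph n → ℕ → Set
TwAtMost H k = Σ (TreeDecomposition H) (λ D → width D ≤ k)

-- Let I be a maximum independent set and use a star as the decomposition tree:
-- the centre bag is V ∖ I, of size n − α, and the leaf of each w ∈ I is its
-- closed neighbourhood, of size at most Δ + 1.  Since I is independent, every
-- edge lies in the centre or in the leaf of its end in I, and a vertex of I
-- lies in no bag except its own leaf; so the bags containing a vertex are
-- either one leaf or include the centre, and hence induce a subtree.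
module Submission where

open import Defs hiding (sym)
open import Data.Nat using (ℕ; zero; suc; _+_; _∸_; _≤_; _⊔_; z≤n; s≤s)
open import Data.Nat.Properties
  using (≤-trans; ≤-reflexive; +-suc; n≤1+n; m≤n+m∸n; ⊔-lub; m≤m⊔n; m≤n⊔m;
         ∸-monoˡ-≤; ∸-monoʳ-≤; module ≤-Reasoning)
open import Data.Bool using (Bool; true; false; T; _∧_; if_then_else_)
open import Data.Bool.Properties using (T-≡; T-∧; T-not-≡)
open import Data.Unit using (⊤; tt)
open import Data.Empty using (⊥-elim)
open import Data.Sum using (_⊎_; inj₁; inj₂)
open import Data.Product using (_×_; _,_; proj₁; proj₂; ∃-syntax)
open import Data.Fin using (Fin; zero; suc)
open import Data.Fin.Subset using (inside; outside; _∈_; _∉_; ∁; _∪_; ⁅_⁆; ∣_∣)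
  renaming (⊥ to ∅)
open import Data.Fin.Subset.Properties
  using (_∈?_; x∈⁅x⁆; x∈⁅y⁆⇒x≡y; x∈p∪q⁺; x∈p∪q⁻; x∉p⇒x∈∁p; x∈∁p⇒x∉p; x∉∁p⇒x∈p;
         ∉⊥; ∣⁅x⁆∣≡1; ∣∁p∣≡n∸∣p∣; ∣⊥∣≡0)
open import Data.Vec using (Vec; []; _∷_; tabulate; map; countᵇ; foldr)
open import Data.Vec.Properties using (lookup∘tabulate; tabulate-∘; map-id; []=⇒lookup; lookup⇒[]=)
import Data.List as List
open import Data.List.Properties using (foldr-preservesᵇ)
open import Data.List.Relation.Unary.All using (All; []; _∷_)
open import Data.List.Relation.Unary.All.Properties using (map⁺)
open import Data.List.Relation.Unary.AllPairs using (_∷_)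
open import Data.List.Relation.Unary.Unique.Propositional using (Unique)
open import Data.List.Extrema.Nat using (argmax; f[xs]≤f[argmax])
open import Function using (Equivalence)
open import Relation.Binary.PropositionalEquality using (_≡_; refl; sym; trans; cong; cong₂; subst)
open import Relation.Nullary using (¬_; yes; no; does)

open Equivalence using (to; from)

∈ₛ⇒∈ : ∀ {n} {v : Fin n} {p : Subset n} → v ∈ₛ p → v ∈ p
∈ₛ⇒∈ {v = v} {p} v∈p = lookup⇒[]= v p (to T-≡ v∈p)

∈⇒∈ₛ : ∀ {n} {v : Fin n} {p : Subset n} → v ∈ p → v ∈ₛ p
∈⇒∈ₛ v∈p = from T-≡ ([]=⇒lookup v∈p)

countᵇ≡∣map∣ : ∀ {A : Set} {n} (p : A → Bool) (xs : Vec A n) → countᵇ p xs ≡ ∣ map p xs ∣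
countᵇ≡∣map∣ p [] = refl
countᵇ≡∣map∣ p (x ∷ xs) with p x
... | true  = cong suc (countᵇ≡∣map∣ p xs)
... | false = countᵇ≡∣map∣ p xs

size≡∣∣ : ∀ {n} (p : Subset n) → size p ≡ ∣ p ∣
size≡∣∣ p = trans (countᵇ≡∣map∣ (λ b → b) p) (cong ∣_∣ (map-id p))

∣p∪q∣≤∣p∣+∣q∣ : ∀ {n} (p q : Subset n) → ∣ p ∪ q ∣ ≤ ∣ p ∣ + ∣ q ∣
∣p∪q∣≤∣p∣+∣q∣ [] [] = z≤n
∣p∪q∣≤∣p∣+∣q∣ (outside ∷ p) (outside ∷ q) = ∣p∪q∣≤∣p∣+∣q∣ p q
∣p∪q∣≤∣p∣+∣q∣ (inside  ∷ p) (outside ∷ q) = s≤s (∣p∪q∣≤∣p∣+∣q∣ p q)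
∣p∪q∣≤∣p∣+∣q∣ (outside ∷ p) (inside  ∷ q) =
  ≤-trans (s≤s (∣p∪q∣≤∣p∣+∣q∣ p q)) (≤-reflexive (sym (+-suc ∣ p ∣ ∣ q ∣)))
∣p∪q∣≤∣p∣+∣q∣ (inside  ∷ p) (inside  ∷ q) =
  s≤s (≤-trans (n≤1+n _)
               (≤-trans (s≤s (∣p∪q∣≤∣p∣+∣q∣ p q)) (≤-reflexive (sym (+-suc ∣ p ∣ ∣ q ∣)))))

maximum : ∀ {n} → Vec ℕ n → ℕ
maximum = foldr (λ _ → ℕ) _⊔_ 0

≤-maximum-tabulate : ∀ {n} (f : Fin n → ℕ) (i : Fin n) → f i ≤ maximum (tabulate f)
≤-maximum-tabulate f zero    = m≤m⊔n (f zero) _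
≤-maximum-tabulate f (suc i) = ≤-trans (≤-maximum-tabulate (λ j → f (suc j)) i) (m≤n⊔m (f zero) _)

maximum-tabulate-≤ : ∀ {n} (f : Fin n → ℕ) {k} → (∀ i → f i ≤ k) → maximum (tabulate f) ≤ k
maximum-tabulate-≤ {zero}  f f≤k = z≤n
maximum-tabulate-≤ {suc n} f f≤k =
  ⊔-lub (f≤k zero) (maximum-tabulate-≤ (λ j → f (suc j)) (λ j → f≤k (suc j)))

Adj-sym : ∀ {n} (G : Graph n) {u v} → Adj G u v → Adj G v u
Adj-sym G {u} {v} = subst T (Graph.sym G u v)

neighbourhood : ∀ {n} → Graph n → Fin n → Subset n
neighbourhood G w = tabulate (adj G w)

∈-neighbourhood⁺ : ∀ {n} (G : Graph n) {w v} → Adj G w v → v ∈ neighbourhood G w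
∈-neighbourhood⁺ G {w} {v} wv = ∈ₛ⇒∈ (subst T (sym (lookup∘tabulate (adj G w) v)) wv)

∈-neighbourhood⁻ : ∀ {n} (G : Graph n) {w v} → v ∈ neighbourhood G w → Adj G w v
∈-neighbourhood⁻ G {w} {v} v∈N = subst T (lookup∘tabulate (adj G w) v) (∈⇒∈ₛ v∈N)

degree≡∣neighbourhood∣ : ∀ {n} (G : Graph n) (w : Fin n) → degree G w ≡ ∣ neighbourhood G w ∣
degree≡∣neighbourhood∣ G w =
  trans (countᵇ≡∣map∣ (adj G w) (tabulate (λ u → u)))
        (cong ∣_∣ (sym (tabulate-∘ (adj G w) (λ u → u))))

closedNeighbourhood : ∀ {n} → Graph n → Fin n → Subset n
closedNeighbourhood G w = ⁅ w ⁆ ∪ neighbourhood G w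

∣closedNeighbourhood∣≤1+maxDegree : ∀ {n} (G : Graph n) (w : Fin n) →
  ∣ closedNeighbourhood G w ∣ ≤ suc (maxDegree G)
∣closedNeighbourhood∣≤1+maxDegree G w = begin
  ∣ ⁅ w ⁆ ∪ neighbourhood G w ∣        ≤⟨ ∣p∪q∣≤∣p∣+∣q∣ ⁅ w ⁆ (neighbourhood G w) ⟩
  ∣ ⁅ w ⁆ ∣ + ∣ neighbourhood G w ∣    ≡⟨ cong₂ _+_ (∣⁅x⁆∣≡1 w) (sym (degree≡∣neighbourhood∣ G w)) ⟩
  suc (degree G w)                      ≤⟨ s≤s (≤-maximum-tabulate (degree G) w) ⟩
  suc (maxDegree G)                     ∎
  where open ≤-Reasoning

Independent : ∀ {n} → Graph n → Subset n → Set
Independent G I = ∀ {u v} → u ∈ I → v ∈ I → ¬ Adj G u v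

∅-independent : ∀ {n} (G : Graph n) → Independent G ∅
∅-independent G u∈∅ = ⊥-elim (∉⊥ u∈∅)

T-and-tabulate : ∀ {n} (f : Fin n → Bool) → T (foldr (λ _ → Bool) _∧_ true (tabulate f)) → ∀ i → T (f i)
T-and-tabulate f t zero    = proj₁ (to T-∧ t)
T-and-tabulate f t (suc i) = T-and-tabulate (λ j → f (suc j)) (proj₂ (to T-∧ t)) i

independentᵇ-sound : ∀ {n} (G : Graph n) {S : Subset n} → T (independentᵇ G S) → Independent G S
independentᵇ-sound G {S} t {u} {v} u∈S v∈S uv =
  subst T (to T-not-≡ (T-and-tabulate _ (T-and-tabulate _ t u) v))
    (from T-∧ (∈⇒∈ₛ u∈S , from T-∧ (∈⇒∈ₛ v∈S , uv)))

maximumIndependentSet : ∀ {n} (G : Graph n) → ∃[ I ] (Independent G I × independenceNumber G ≤ ∣ I ∣)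
maximumIndependentSet {n} G = independentWitness heaviest α≤weight
  where
  weight : Subset n → ℕ
  weight S = if independentᵇ G S then size S else 0
  heaviest : Subset n
  heaviest = argmax weight ∅ (allSubsets n)
  α≤weight : independenceNumber G ≤ weight heaviest
  α≤weight = foldr-preservesᵇ {P = _≤ weight heaviest} ⊔-lub z≤n
               (map⁺ (f[xs]≤f[argmax] ∅ (allSubsets n)))
  independentWitness : ∀ S {k} → k ≤ (if independentᵇ G S then size S else 0) →
    ∃[ I ] (Independent G I × k ≤ ∣ I ∣)
  independentWitness S k≤ with independentᵇ G S in eq
  ... | true  = S , independentᵇ-sound G (from T-≡ eq) , ≤-trans k≤ (≤-reflexive (size≡∣∣ S))
  ... | false = ∅ , ∅-independent G , ≤-trans k≤ z≤n

starAdj : ∀ {k} → Fin (suc k) → Fin (suc k) → Bool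
starAdj zero    zero    = false
starAdj zero    (suc _) = true
starAdj (suc _) zero    = true
starAdj (suc _) (suc _) = false

star : ∀ k → Graph (suc k)
star k = record { adj = starAdj ; sym = starAdj-sym ; irrefl = starAdj-irrefl }
  where
  starAdj-sym : ∀ u v → starAdj u v ≡ starAdj v u
  starAdj-sym zero    zero    = refl
  starAdj-sym zero    (suc _) = refl
  starAdj-sym (suc _) zero    = refl
  starAdj-sym (suc _) (suc _) = refl
  starAdj-irrefl : ∀ v → starAdj v v ≡ false
  starAdj-irrefl zero    = refl
  starAdj-irrefl (suc _) = refl

walk-via-centre : ∀ {k} (P : Fin (suc k) → Set) {x y} → P x → P zero → P y →
  ∃[ vs ] (Walk (star k) x y vs × All P vs)
walk-via-centre P {zero}  {zero}  Px _  _  = _ , here zero , Px ∷ []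
walk-via-centre P {zero}  {suc y} Px _  Py = _ , step tt (here (suc y)) , Px ∷ Py ∷ []
walk-via-centre P {suc x} {zero}  Px _  Py = _ , step tt (here zero) , Px ∷ Py ∷ []
walk-via-centre P {suc x} {suc y} Px P0 Py =
  _ , step {y = zero} tt (step tt (here (suc y))) , Px ∷ P0 ∷ Py ∷ []

-- Every edge of a star meets the centre, and a path passes the centre at most once.
star-acyclic : ∀ k → ¬ HasCycle (star k)
star-acyclic k (_ , _ , _ , walk , distinct , long , closing) = noCycle walk distinct long closing
  where
  noCycle : ∀ {x y vs} → Walk (star k) x y vs → Unique vs → 3 ≤ List.length vs →
            ¬ Adj (star k) y x
  noCycle (here _) _ (s≤s ())
  noCycle (step _ (here _)) _ (s≤s (s≤s ()))
  noCycle {zero}  (step {y = zero} () _)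
  noCycle {suc _} (step {y = suc _} () _)
  noCycle {zero}  (step {y = suc _} _ (step {y = suc _} () _))
  noCycle {zero}  (step {y = suc _} _ (step {y = zero} _ (here _)))
    ((_ ∷ x≢v₂ ∷ _) ∷ _) _ _ = x≢v₂ refl
  noCycle {zero}  (step {y = suc _} _ (step {y = zero} _ (step _ _)))
    ((_ ∷ x≢v₂ ∷ _) ∷ _) _ _ = x≢v₂ refl
  noCycle {suc _} (step {y = zero} _ (step {y = zero} () _))
  noCycle {suc _} (step {y = zero} _ (step {y = suc _} _ (here _))) _ _ ()
  noCycle {suc _} (step {y = zero} _ (step {y = suc _} _ (step {y = suc _} () _)))
  noCycle {suc _} (step {y = zero} _ (step {y = suc _} _ (step {y = zero} _ (here _))))
    (_ ∷ (_ ∷ v₁≢v₃ ∷ _) ∷ _) _ _ = v₁≢v₃ refl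
  noCycle {suc _} (step {y = zero} _ (step {y = suc _} _ (step {y = zero} _ (step _ _))))
    (_ ∷ (_ ∷ v₁≢v₃ ∷ _) ∷ _) _ _ = v₁≢v₃ refl

star-isTree : ∀ k → IsTree (star k)
star-isTree k = s≤s z≤n , star-connected , star-acyclic k
  where
  star-connected : Connected (star k)
  star-connected x y = let vs , walk , _ = walk-via-centre (λ _ → ⊤) tt tt tt in vs , walk

starDecomposition : ∀ {n k} {H : Graph n} (bag : Fin (suc k) → Subset n) →
  (∀ v → ∃[ x ] v ∈ bag x) →
  (∀ {u v} → Adj H u v → ∃[ x ] (u ∈ bag x × v ∈ bag x)) →
  (∀ {v x y} → v ∉ bag zero → v ∈ bag x → v ∈ bag y → x ≡ y) →
  TreeDecomposition H
starDecomposition {k = k} bag covers edges unique-leaf = record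
  { m = suc k ; tree = star k ; isTree = star-isTree k ; bag = bag
  ; nonempty = λ v → let x , v∈x = covers v in x , ∈⇒∈ₛ v∈x
  ; connected = bags-of-vertex-connected
  ; edges = λ u v uv → let x , u∈x , v∈x = edges uv in x , ∈⇒∈ₛ u∈x , ∈⇒∈ₛ v∈x
  }
  where
  bags-of-vertex-connected : ∀ v x y → v ∈ₛ bag x → v ∈ₛ bag y →
    ∃[ vs ] (Walk (star k) x y vs × All (λ z → v ∈ₛ bag z) vs)
  bags-of-vertex-connected v x y v∈x v∈y with v ∈? bag zero
  ... | yes v∈centre = walk-via-centre (λ z → v ∈ₛ bag z) v∈x (∈⇒∈ₛ v∈centre) v∈y
  ... | no  v∉centre with unique-leaf v∉centre (∈ₛ⇒∈ v∈x) (∈ₛ⇒∈ v∈y)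
  ...   | refl = _ , here x , v∈x ∷ []

width≤ : ∀ {n} {H : Graph n} (D : TreeDecomposition H) {k} →
  (∀ x → ∣ bag D x ∣ ≤ suc k) → width D ≤ k
width≤ D ∣bag∣≤ = ∸-monoˡ-≤ 1 (maximum-tabulate-≤ (λ x → size (bag D x)) size≤)
  where
  size≤ : ∀ x → size (bag D x) ≤ _
  size≤ x = subst (_≤ _) (sym (size≡∣∣ (bag D x))) (∣bag∣≤ x)

module _ {n} (H : Graph n) {I : Subset n} (independent : Independent H I) where

  leafBag : Fin n → Subset n
  leafBag w = if does (w ∈? I) then closedNeighbourhood H w else ∅

  ∈-leafBag⁺ : ∀ {v w} → w ∈ I → v ≡ w ⊎ Adj H w v → v ∈ leafBag w
  ∈-leafBag⁺ {v} {w} w∈I v~w with w ∈? I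
  ... | no w∉I = ⊥-elim (w∉I w∈I)
  ... | yes _ with v~w
  ...   | inj₁ refl = x∈p∪q⁺ (inj₁ (x∈⁅x⁆ w))
  ...   | inj₂ wv   = x∈p∪q⁺ (inj₂ (∈-neighbourhood⁺ H wv))

  ∈-leafBag⁻ : ∀ {v w} → v ∈ leafBag w → w ∈ I × (v ≡ w ⊎ Adj H w v)
  ∈-leafBag⁻ {v} {w} v∈leaf with w ∈? I
  ... | no _ = ⊥-elim (∉⊥ v∈leaf)
  ... | yes w∈I with x∈p∪q⁻ ⁅ w ⁆ (neighbourhood H w) v∈leaf
  ...   | inj₁ v∈⁅w⁆ = w∈I , inj₁ (x∈⁅y⁆⇒x≡y w v∈⁅w⁆)
  ...   | inj₂ v∈N   = w∈I , inj₂ (∈-neighbourhood⁻ H v∈N)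

  ∣leafBag∣≤1+maxDegree : ∀ w → ∣ leafBag w ∣ ≤ suc (maxDegree H)
  ∣leafBag∣≤1+maxDegree w with does (w ∈? I)
  ... | true  = ∣closedNeighbourhood∣≤1+maxDegree H w
  ... | false = ≤-trans (≤-reflexive (∣⊥∣≡0 n)) z≤n

  bags : Fin (suc n) → Subset n
  bags zero    = ∁ I
  bags (suc w) = leafBag w

  covers : ∀ v → ∃[ x ] v ∈ bags x
  covers v with v ∈? I
  ... | yes v∈I = suc v , ∈-leafBag⁺ v∈I (inj₁ refl)
  ... | no  v∉I = zero , x∉p⇒x∈∁p v∉I

  edge-in-bag : ∀ {u v} → Adj H u v → ∃[ x ] (u ∈ bags x × v ∈ bags x)
  edge-in-bag {u} {v} uv with u ∈? I | v ∈? I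
  ... | yes u∈I | yes v∈I = ⊥-elim (independent u∈I v∈I uv)
  ... | yes u∈I | no  _   = suc u , ∈-leafBag⁺ u∈I (inj₁ refl) , ∈-leafBag⁺ u∈I (inj₂ uv)
  ... | no  _   | yes v∈I =
    suc v , ∈-leafBag⁺ v∈I (inj₂ (Adj-sym H uv)) , ∈-leafBag⁺ v∈I (inj₁ refl)
  ... | no  u∉I | no  v∉I = zero , x∉p⇒x∈∁p u∉I , x∉p⇒x∈∁p v∉I

  own-leaf : ∀ {v x} → v ∈ I → v ∈ bags x → x ≡ suc v
  own-leaf {x = zero}  v∈I v∈∁I = ⊥-elim (x∈∁p⇒x∉p v∈∁I v∈I)
  own-leaf {x = suc w} v∈I v∈leaf with ∈-leafBag⁻ {w = w} v∈leaf
  ... | _   , inj₁ refl = refl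
  ... | w∈I , inj₂ wv   = ⊥-elim (independent w∈I v∈I wv)

  independentSetDecomposition : TreeDecomposition H
  independentSetDecomposition = starDecomposition bags covers edge-in-bag λ v∉∁I v∈x v∈y →
    let v∈I = x∉∁p⇒x∈p v∉∁I in trans (own-leaf v∈I v∈x) (sym (own-leaf v∈I v∈y))

lemma10 : ∀ (n : ℕ) (H : Graph n) →
    TwAtMost H (maxDegree H ⊔ (n ∸ independenceNumber H ∸ 1))
lemma10 n H with maximumIndependentSet H
... | I , independent , α≤∣I∣ = D , width≤ D ∣bag∣≤
  where
  D : TreeDecomposition H
  D = independentSetDecomposition H independent
  Δ α : ℕ
  Δ = maxDegree H
  α = independenceNumber H
  ∣bag∣≤ : ∀ x → ∣ bags H independent x ∣ ≤ suc (Δ ⊔ (n ∸ α ∸ 1))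
  ∣bag∣≤ zero = begin
    ∣ ∁ I ∣               ≡⟨ ∣∁p∣≡n∸∣p∣ I ⟩
    n ∸ ∣ I ∣             ≤⟨ ∸-monoʳ-≤ n α≤∣I∣ ⟩
    n ∸ α                 ≤⟨ m≤n+m∸n (n ∸ α) 1 ⟩
    suc (n ∸ α ∸ 1)       ≤⟨ s≤s (m≤n⊔m Δ _) ⟩
    suc (Δ ⊔ (n ∸ α ∸ 1)) ∎
    where open ≤-Reasoning
  ∣bag∣≤ (suc w) = ≤-trans (∣leafBag∣≤1+maxDegree H independent w) (s≤s (m≤m⊔n Δ _))
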